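{- Let $n,\delta\in\mathbb{N}$ with $\delta\geq 3$ and $n\geq 6$. If $G$ is a connected $C_4$-free graph of order $n$ and minimum degree $\delta$, then \[\operatorname{diam}(G)-\pi(G)\leq \frac{15n}{4\left(\delta^2-2\lfloor\frac{\delta}{2}\rfloor +1\right)}+\frac{7}{4}.\]
   Context: All graphs are finite and simple. For a connected graph $G$ of order $n\ge 2$ and a vertex $v$, $\overline{\sigma}(v)=\frac{1}{n-1}\sum_{w\in V(G)}d(v,w)$, where $d$ is the shortest-path distance, and the proximity is $\pi(G)=\min_{v\in V(G)}\overline{\sigma}(v)$. $\operatorname{diam}(G)$ is the diameter. A graph is $C_4$-free if it does not contain a $4$-cycle as a (not necessarily induced) subgraph. -}

module Defs where

open import Data.Nat as ℕ using (ℕ; zero; suc; _+_; _*_; _∸_; _≤_; _/_; _⊔_)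
open import Data.Fin using (Fin; zero; suc)
open import Data.Bool using (Bool; true; false; T)
open import Data.List using (List; length; filterᵇ; allFin; map)
open import Data.Nat.ListAction using (sum)
open import Data.Integer using (+_)
open import Data.Rational as ℚ using (ℚ)
open import Data.Product using (Σ; ∃; _×_; _,_)
open import Relation.Binary.PropositionalEquality using (_≡_; _≢_)
open import Relation.Nullary using (¬_)

record Graph (n : ℕ) : Set where
  field
    adj   : Fin n → Fin n → Bool
    sym   : ∀ u v → adj u v ≡ adj v u
    irrefl : ∀ v → adj v v ≡ false
open Graph public

module _ {n : ℕ} (G : Graph n) where

  Adj : Fin n → Fin n → Set
  Adj u v = T (adj G u v)

  data Walk : Fin n → Fin n → ℕ → Set where
    here : ∀ {v} → Walk v v 0
    step : ∀ {u w v k} → Adj u w → Walk w v k → Walk u v (suc k)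

  Connected : Set
  Connected = ∀ u v → ∃ λ k → Walk u v k

  IsDistance : (Fin n → Fin n → ℕ) → Set
  IsDistance D = ∀ u v → Walk u v (D u v) × (∀ k → Walk u v k → D u v ≤ k)

  degree : Fin n → ℕ
  degree v = length (filterᵇ (adj G v) (allFin n))

  MinDegree : ℕ → Set
  MinDegree δ = (∀ v → δ ≤ degree v) × (∃ λ v → degree v ≡ δ)

  C4Free : Set
  C4Free = ¬ (Σ (Fin n) λ a → Σ (Fin n) λ b → Σ (Fin n) λ c → Σ (Fin n) λ d →
              a ≢ b × a ≢ c × a ≢ d × b ≢ c × b ≢ d × c ≢ d ×
              Adj a b × Adj b c × Adj c d × Adj d a)

-- maximum / minimum of a function over Fin k (value 0 for k = 0)
maxFin : ∀ {k} → (Fin k → ℕ) → ℕ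
maxFin {zero} f = 0
maxFin {suc k} f = f zero ⊔ maxFin (λ i → f (suc i))

minFinℚ : ∀ {k} → (Fin k → ℚ) → ℚ
minFinℚ {zero} f = ℚ.0ℚ
minFinℚ {suc zero} f = f zero
minFinℚ {suc (suc k)} f = f zero ℚ.⊓ minFinℚ (λ i → f (suc i))

-- s / d as a rational (0 when d = 0; only used with d = n - 1 ≥ 1)
avg : ℕ → ℕ → ℚ
avg s zero = ℚ.0ℚ
avg s (suc d) = (+ s) ℚ./ suc d

module _ {n : ℕ} (D : Fin n → Fin n → ℕ) where

  diam : ℕ
  diam = maxFin (λ u → maxFin (λ v → D u v))

  σ̄ : Fin n → ℚ
  σ̄ v = avg (sum (map (D v) (allFin n))) (n ∸ 1)

  proximity : ℚ
  proximity = minFinℚ σ̄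

bound : ℕ → ℕ → ℚ
bound n δ = ((+ (15 * n)) ℚ./ (4 * suc (δ * δ ∸ 2 * (δ / 2)))) ℚ.+ ((+ 7) ℚ./ 4)

module Submission where

-- Let c = δ² − 2⌊δ/2⌋ + 1. In a C₄-free graph every ball of radius 2 has at least c vertices: the
-- neighbours u of y have pairwise no common neighbour besides y, each has at most one neighbour inside
-- N(y), and these inner edges are counted an even number M ≤ deg y of times, so the ball has at least
-- 1 + deg y · δ − M ≥ c vertices.
-- Along a diametral pair x₀, x₁ at distance d pick vertices at distance 0, 5, …, 5m from x₀ (m = ⌊d/5⌋).
-- Their balls of radius 2 are disjoint, so (m + 1)c ≤ n, and a vertex v with p = d(v, x₀) is at distance
-- at least |5i − p| − 2 from the whole i-th ball, so Σ_w d(v, w) ≥ c Σ_i (|5i − p| − 2) ≥ c(5m² − m − 6)/4.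
-- With d ≤ 5m + 4 this yields d − σ̄(v) ≤ 15n/(4c) + 7/4.

open import Defs renaming (sym to adj-sym)
open import Data.Bool using (Bool; true; false; T)
open import Data.Empty using (⊥-elim)
import Data.Fin
open import Data.Fin using (Fin; zero; suc; toℕ)
open import Data.Fin.Properties using (toℕ<n; toℕ-injective; toℕ-inject₁; toℕ-fromℕ)
  renaming (suc-injective to Fin-suc-injective)
open import Data.Integer as ℤ using (+≤+)
open import Data.Integer.Properties using (pos-*) renaming (*-identityʳ to ℤ-*-identityʳ)
open import Data.List using ([]; _∷_; length; filterᵇ; allFin; map; tabulate)
import Data.List.Properties as List
import Data.Nat.ListAction as List
open import Data.Nat
open import Data.Nat.DivMod using (m/n*n≤m; m*n/n≡m; /-monoˡ-≤; m≡m%n+[m/n]*n; m%n<n)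
open import Data.Nat.Properties
open import Algebra.Properties.Semiring.Sum +-*-semiring
  using (sum; sum-syntax; ∑-distrib-+; ∑-comm; *-distribˡ-sum; *-distribʳ-sum; sum-cong-≗; sum-init-last)
open import Data.Nat.Tactic.RingSolver using (solve; solve-∀)
open import Data.Product using (Σ; ∃; _×_; _,_; proj₁; proj₂; map₂)
open import Data.Rational as ℚ using (ℚ)
open import Data.Rational.Properties using (toℚᵘ-cancel-≤; toℚᵘ-homo-+; toℚᵘ-homo‿-; toℚᵘ-fromℚᵘ)
  renaming (⊓-sel to ℚ-⊓-sel)
open import Data.Rational.Unnormalised as ℚᵘ using (mkℚᵘ; *≤*)
import Data.Rational.Unnormalised.Properties as ℚᵘ
open import Data.Sum using (inj₁; inj₂)
open import Data.Unit using (tt)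
open import Function using (_∘_; id)
open import Relation.Binary.PropositionalEquality
open import Relation.Nullary using (yes; no)

private
  variable
    k : ℕ

𝟙 : Bool → ℕ
𝟙 true = 1
𝟙 false = 0

𝟙≤1 : ∀ b → 𝟙 b ≤ 1
𝟙≤1 true = ≤-refl
𝟙≤1 false = z≤n

𝟙*≤ : ∀ b n → 𝟙 b * n ≤ n
𝟙*≤ true n = ≤-reflexive (+-identityʳ n)
𝟙*≤ false n = z≤n

𝟙*≤-if : ∀ b {a X} → (T b → a ≤ X) → 𝟙 b * a ≤ X
𝟙*≤-if true {a} a≤X = subst (_≤ _) (sym (+-identityʳ a)) (a≤X tt)
𝟙*≤-if false _ = z≤n

𝟙*>0 : ∀ b {a} → 0 < 𝟙 b * a → T b
𝟙*>0 true _ = tt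

𝟙-partition : ∀ d → 𝟙 (d ≡ᵇ 0) + 𝟙 (d ≡ᵇ 1) + 𝟙 (2 ≤ᵇ d) ≡ 1
𝟙-partition 0 = refl
𝟙-partition 1 = refl
𝟙-partition (2+ _) = refl

𝟙-≤ᵇ2-partition : ∀ d → 𝟙 (d ≡ᵇ 0) + 𝟙 (d ≡ᵇ 1) + 𝟙 (d ≡ᵇ 2) ≡ 𝟙 (d ≤ᵇ 2)
𝟙-≤ᵇ2-partition 0 = refl
𝟙-≤ᵇ2-partition 1 = refl
𝟙-≤ᵇ2-partition 2 = refl
𝟙-≤ᵇ2-partition (suc (2+ _)) = refl

sum-mono-≤ : {f g : Fin k → ℕ} → (∀ i → f i ≤ g i) → sum f ≤ sum g
sum-mono-≤ {zero} f≤g = z≤n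
sum-mono-≤ {suc k} f≤g = +-mono-≤ (f≤g zero) (sum-mono-≤ (f≤g ∘ suc))

sum-zero : ∀ k → sum {k} (λ _ → 0) ≡ 0
sum-zero zero = refl
sum-zero (suc k) = sum-zero k

∑-distrib-+₃ : (f g h : Fin k → ℕ) →
  ∑[ i < k ] (f i + g i + h i) ≡ ∑[ i < k ] f i + ∑[ i < k ] g i + ∑[ i < k ] h i
∑-distrib-+₃ f g h = trans (∑-distrib-+ (λ i → f i + g i) h) (cong (_+ sum h) (∑-distrib-+ f g))

sum-const : ∀ k a → sum {k} (λ _ → a) ≡ k * a
sum-const zero a = refl
sum-const (suc k) a = cong (a +_) (sum-const k a)

f≤sum : (f : Fin k → ℕ) (i : Fin k) → f i ≤ sum f
f≤sum f zero = m≤m+n _ _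
f≤sum f (suc i) = ≤-trans (f≤sum (f ∘ suc) i) (m≤n+m _ _)

AtMostOneNonZero : (Fin k → ℕ) → Set
AtMostOneNonZero f = ∀ i j → 0 < f i → 0 < f j → i ≡ j

sum≤-atMostOneNonZero : ∀ {X} (f : Fin k → ℕ) → (∀ i → f i ≤ X) → AtMostOneNonZero f → sum f ≤ X
sum≤-atMostOneNonZero {zero} f f≤X unique = z≤n
sum≤-atMostOneNonZero {suc k} {X} f f≤X unique with f zero in f₀≡
... | zero = sum≤-atMostOneNonZero (f ∘ suc) (f≤X ∘ suc)
               (λ i j p q → Fin-suc-injective (unique (suc i) (suc j) p q))
... | suc a = begin
  suc a + sum (f ∘ suc)   ≤⟨ +-monoʳ-≤ (suc a) (sum-mono-≤ tail≤0) ⟩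
  suc a + sum {k} (λ _ → 0) ≡⟨ cong (suc a +_) (sum-zero k) ⟩
  suc a + 0               ≡⟨ +-identityʳ (suc a) ⟩
  suc a                   ≡⟨ f₀≡ ⟨
  f zero                  ≤⟨ f≤X zero ⟩
  X                       ∎
  where
  open ≤-Reasoning
  tail≤0 : ∀ i → f (suc i) ≤ 0
  tail≤0 i with f (suc i) in fᵢ≡
  ... | zero = z≤n
  ... | suc _ with () ← unique zero (suc i) (subst (0 <_) (sym f₀≡) z<s) (subst (0 <_) (sym fᵢ≡) z<s)

sum-symmetric-even : (s : Fin k → Fin k → ℕ) → (∀ i j → s i j ≡ s j i) → (∀ i → s i i ≡ 0) →
  ∃ λ h → ∑[ i < k ] ∑[ j < k ] s i j ≡ h + h
sum-symmetric-even {zero} s sym-s diag-s = 0 , refl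
sum-symmetric-even {suc k} s sym-s diag-s
  with h , ∑∑≡h+h ← sum-symmetric-even (λ i j → s (suc i) (suc j)) (λ i j → sym-s (suc i) (suc j)) (diag-s ∘ suc) =
  row + h , (begin
    s zero zero + row + ∑[ i < k ] (s (suc i) zero + ∑[ j < k ] s (suc i) (suc j))
      ≡⟨ cong₂ _+_ (cong (_+ row) (diag-s zero)) (∑-distrib-+ (λ i → s (suc i) zero) _) ⟩
    row + (∑[ i < k ] s (suc i) zero + rest)
      ≡⟨ cong (λ t → row + (t + rest)) (sum-cong-≗ λ i → sym-s (suc i) zero) ⟩
    row + (row + rest)
      ≡⟨ cong (λ t → row + (row + t)) ∑∑≡h+h ⟩
    row + (row + (h + h))
      ≡⟨ regroup row h ⟩
    row + h + (row + h) ∎)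
  where
  open ≡-Reasoning
  row rest : ℕ
  row = ∑[ j < k ] s zero (suc j)
  rest = ∑[ i < k ] ∑[ j < k ] s (suc i) (suc j)
  regroup : ∀ a b → a + (a + (b + b)) ≡ a + b + (a + b)
  regroup = solve-∀

sum-tabulate : (f : Fin k → ℕ) → List.sum (tabulate f) ≡ sum f
sum-tabulate {zero} f = refl
sum-tabulate {suc k} f = cong (f zero +_) (sum-tabulate (f ∘ suc))

sum-map-allFin : (f : Fin k → ℕ) → List.sum (map f (allFin k)) ≡ sum f
sum-map-allFin f = trans (cong List.sum (List.map-tabulate id f)) (sum-tabulate f)

length-filterᵇ-tabulate : {A : Set} (p : A → Bool) (g : Fin k → A) →
  length (filterᵇ p (tabulate g)) ≡ ∑[ i < k ] 𝟙 (p (g i))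
length-filterᵇ-tabulate {zero} p g = refl
length-filterᵇ-tabulate {suc k} p g with p (g zero)
... | true = cong suc (length-filterᵇ-tabulate p (g ∘ suc))
... | false = length-filterᵇ-tabulate p (g ∘ suc)

∣5m-5n∣≤4⇒m≡n : ∀ {m n} → ∣ 5 * m - 5 * n ∣ ≤ 4 → m ≡ n
∣5m-5n∣≤4⇒m≡n {m} {n} ≤4 =
  ∣m-n∣≡0⇒m≡n (n<1⇒n≡0 (*-cancelˡ-< 5 ∣ m - n ∣ 1 (s≤s (subst (_≤ 4) (sym (*-distribˡ-∣-∣ 5 m n)) ≤4))))

∣m-n∣≤o : ∀ {m n o} → m ≤ n + o → n ≤ m + o → ∣ m - n ∣ ≤ o
∣m-n∣≤o {m} {n} {o} m≤n+o n≤m+o with ∣m-n∣≡[m∸n]∨[n∸m] m n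
... | inj₁ eq = subst (_≤ o) (sym eq) (m≤n+o⇒m∸n≤o m n m≤n+o)
... | inj₂ eq = subst (_≤ o) (sym eq) (m≤n+o⇒m∸n≤o n m n≤m+o)

minBall₂ : ℕ → ℕ
minBall₂ δ = suc (δ * δ ∸ 2 * (δ / 2))

2*[m/2]≤m : ∀ m → 2 * (m / 2) ≤ m
2*[m/2]≤m m = subst (_≤ m) (*-comm (m / 2) 2) (m/n*n≤m m 2)

δ*δ+2h≤g*δ+2*[δ/2] : ∀ {δ g h} → 2 ≤ δ → δ ≤ g → h + h ≤ g → δ * δ + (h + h) ≤ g * δ + 2 * (δ / 2)
δ*δ+2h≤g*δ+2*[δ/2] {δ} {g} {h} 2≤δ δ≤g 2h≤g with m≤n⇒m<n∨m≡n δ≤g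
... | inj₂ refl = +-monoʳ-≤ (δ * δ) (begin
  h + h         ≡⟨ trans h+h≡h*2 (*-comm h 2) ⟩
  2 * h         ≤⟨ *-monoʳ-≤ 2 h≤δ/2 ⟩
  2 * (δ / 2)   ∎)
  where
  open ≤-Reasoning
  h+h≡h*2 : h + h ≡ h * 2
  h+h≡h*2 = solve (h ∷ [])
  h≤δ/2 : h ≤ δ / 2
  h≤δ/2 = subst (_≤ δ / 2) (m*n/n≡m h 2) (/-monoˡ-≤ 2 (subst (_≤ δ) h+h≡h*2 2h≤g))
δ*δ+2h≤g*δ+2*[δ/2] {δ@(suc δ')} {g} {h} 2≤δ δ≤g 2h≤g | inj₁ δ<g = begin
  δ * δ + (h + h)          ≤⟨ +-monoʳ-≤ (δ * δ) 2h≤g ⟩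
  δ * δ + g                ≡⟨ solve (δ' ∷ g ∷ []) ⟩
  g + 1 + suc δ * δ'       ≤⟨ +-monoʳ-≤ (g + 1) (*-monoˡ-≤ δ' δ<g) ⟩
  g + 1 + g * δ'           ≡⟨ solve (δ' ∷ g ∷ []) ⟩
  g * δ + 1                ≤⟨ +-monoʳ-≤ (g * δ) (≤-trans (s≤s z≤n) (*-monoʳ-≤ 2 (/-monoˡ-≤ 2 2≤δ))) ⟩
  g * δ + 2 * (δ / 2)      ∎
  where open ≤-Reasoning

minBall₂≤ : ∀ {δ g h B} → 2 ≤ δ → δ ≤ g → h + h ≤ g → 1 + g * δ ≤ B + (h + h) → minBall₂ δ ≤ B
minBall₂≤ {δ} {g} {h} {B} 2≤δ δ≤g 2h≤g 1+gδ≤B+2h = +-cancelʳ-≤ (h + h) (minBall₂ δ) B (begin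
  suc (δ * δ ∸ 2 * (δ / 2)) + (h + h)  ≡⟨ cong suc (+-∸-comm (h + h) 2[δ/2]≤δ*δ) ⟨
  suc (δ * δ + (h + h) ∸ 2 * (δ / 2))
    ≤⟨ s≤s (∸-monoˡ-≤ (2 * (δ / 2)) (δ*δ+2h≤g*δ+2*[δ/2] {h = h} 2≤δ δ≤g 2h≤g)) ⟩
  suc (g * δ + 2 * (δ / 2) ∸ 2 * (δ / 2)) ≡⟨ cong suc (m+n∸n≡m (g * δ) (2 * (δ / 2))) ⟩
  1 + g * δ                            ≤⟨ 1+gδ≤B+2h ⟩
  B + (h + h)                          ∎)
  where
  open ≤-Reasoning
  2[δ/2]≤δ*δ : 2 * (δ / 2) ≤ δ * δ
  2[δ/2]≤δ*δ = ≤-trans (2*[m/2]≤m δ) (m≤m*n δ δ {{>-nonZero (≤-trans (s≤s z≤n) 2≤δ)}})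

k*d≤∣ks-p∣+∣k[s+d]-p∣ : ∀ k s d p → k * d ≤ ∣ k * s - p ∣ + ∣ k * (s + d) - p ∣
k*d≤∣ks-p∣+∣k[s+d]-p∣ k s d p = begin
  k * d                                   ≡⟨ ∣m-m+n∣≡n (k * s) (k * d) ⟨
  ∣ k * s - k * s + k * d ∣               ≡⟨ cong (λ t → ∣ k * s - t ∣) (*-distribˡ-+ k s d) ⟨
  ∣ k * s - k * (s + d) ∣                 ≤⟨ ∣-∣-triangle (k * s) p (k * (s + d)) ⟩
  ∣ k * s - p ∣ + ∣ p - k * (s + d) ∣     ≡⟨ cong (∣ k * s - p ∣ +_) (∣-∣-comm p (k * (s + d))) ⟩
  ∣ k * s - p ∣ + ∣ k * (s + d) - p ∣     ∎
  where open ≤-Reasoning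

k*m*[m+2]≤4*∑∣k[s+i]-p∣ : ∀ k p m s → k * m * (m + 2) ≤ 4 * ∑[ i < suc m ] ∣ k * (s + toℕ i) - p ∣
k*m*[m+2]≤4*∑∣k[s+i]-p∣ k p zero s = ≤-trans (≤-reflexive (cong (_* 2) (*-zeroʳ k))) z≤n
k*m*[m+2]≤4*∑∣k[s+i]-p∣ k p 1 s = begin
  k * 1 * 3                                        ≤⟨ *-monoʳ-≤ (k * 1) (n≤1+n 3) ⟩
  k * 1 * 4                                        ≡⟨ *-comm (k * 1) 4 ⟩
  4 * (k * 1)                                      ≤⟨ *-monoʳ-≤ 4 (k*d≤∣ks-p∣+∣k[s+d]-p∣ k s 1 p) ⟩
  4 * (∣ k * s - p ∣ + ∣ k * (s + 1) - p ∣)        ≡⟨ cong₂ (λ a b → 4 * (∣ k * a - p ∣ + b)) (+-identityʳ s)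
                                                            (+-identityʳ ∣ k * (s + 1) - p ∣) ⟨
  4 * ∑[ i < 2 ] ∣ k * (s + toℕ i) - p ∣          ∎
  where open ≤-Reasoning
k*m*[m+2]≤4*∑∣k[s+i]-p∣ k p (2+ m) s = begin
  k * (2 + m) * (2 + m + 2)                         ≡⟨ solve (k ∷ m ∷ []) ⟩
  4 * (k * (2 + m)) + k * m * (m + 2)               ≤⟨ +-mono-≤ (*-monoʳ-≤ 4 (k*d≤∣ks-p∣+∣k[s+d]-p∣ k s (2 + m) p))
                                                                (k*m*[m+2]≤4*∑∣k[s+i]-p∣ k p m (suc s)) ⟩
  4 * (∣ k * s - p ∣ + gₗ) + 4 * inner              ≡⟨ regroup ∣ k * s - p ∣ gₗ inner ⟩
  4 * (∣ k * s - p ∣ + (inner + gₗ))                ≡⟨ cong₂ (λ a b → 4 * (∣ k * a - p ∣ + b)) (+-identityʳ s) ends ⟨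
  4 * ∑[ i < 3 + m ] g i                             ∎
  where
  open ≤-Reasoning
  g : Fin (3 + m) → ℕ
  g i = ∣ k * (s + toℕ i) - p ∣
  gₗ inner : ℕ
  gₗ = ∣ k * (s + (2 + m)) - p ∣
  inner = ∑[ i < suc m ] ∣ k * (suc s + toℕ i) - p ∣
  regroup : ∀ a b c → 4 * (a + b) + 4 * c ≡ 4 * (a + (c + b))
  regroup = solve-∀
  ends : ∑[ i < 2 + m ] g (suc i) ≡ inner + gₗ
  ends = trans (sum-init-last (λ i → g (suc i)))
    (cong₂ _+_ (sum-cong-≗ {suc m} λ i →
                  cong (λ t → ∣ k * t - p ∣) (trans (+-suc s _) (cong (suc s +_) (toℕ-inject₁ i))))
               (cong (λ t → ∣ k * (s + suc t) - p ∣) (toℕ-fromℕ (suc m))))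

5*m*m≤4*∑[∣5i-p∣∸2]+m+6 : ∀ p m → 5 * m * m ≤ 4 * ∑[ i < suc m ] (∣ 5 * toℕ i - p ∣ ∸ 2) + m + 6
5*m*m≤4*∑[∣5i-p∣∸2]+m+6 p zero = z≤n
5*m*m≤4*∑[∣5i-p∣∸2]+m+6 p m@(suc m′) = +-cancelʳ-≤ (10 * m) _ _ (begin
  5 * m * m + 10 * m                ≡⟨ solve (m′ ∷ []) ⟩
  5 * m * (m + 2)                   ≤⟨ k*m*[m+2]≤4*∑∣k[s+i]-p∣ 5 p m 0 ⟩
  4 * ∑[ i < suc m ] ∣ 5 * toℕ i - p ∣ ≤⟨ *-monoʳ-≤ 4 ∑∣5i-p∣≤ ⟩
  4 * (suc m * 2 + t)               ≡⟨ expand₁ m′ t ⟩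
  4 * t + 16 + 8 * m′               ≤⟨ +-mono-≤ (+-monoʳ-≤ (4 * t) (n≤1+n 16)) (*-monoˡ-≤ m′ (m≤m+n 8 3)) ⟩
  4 * t + 17 + 11 * m′              ≡⟨ expand₂ m′ t ⟩
  4 * t + m + 6 + 10 * m            ∎)
  where
  open ≤-Reasoning
  t : ℕ
  t = ∑[ i < suc m ] (∣ 5 * toℕ i - p ∣ ∸ 2)
  expand₁ : ∀ m′ t → 4 * (2 + suc m′ * 2 + t) ≡ 4 * t + 16 + 8 * m′
  expand₁ = solve-∀
  expand₂ : ∀ m′ t → 4 * t + 17 + 11 * m′ ≡ 4 * t + suc m′ + 6 + 10 * suc m′
  expand₂ = solve-∀
  ∑∣5i-p∣≤ : ∑[ i < suc m ] ∣ 5 * toℕ i - p ∣ ≤ suc m * 2 + t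
  ∑∣5i-p∣≤ = ≤-trans (sum-mono-≤ {suc m} (λ i → m≤n+m∸n ∣ 5 * toℕ i - p ∣ 2))
                     (≤-reflexive (trans (∑-distrib-+ {suc m} (λ _ → 2) (λ i → ∣ 5 * toℕ i - p ∣ ∸ 2))
                                         (cong (_+ t) (sum-const (suc m) 2))))

m≤5*[m/5]+4 : ∀ m → m ≤ 5 * (m / 5) + 4
m≤5*[m/5]+4 m = begin
  m                       ≡⟨ m≡m%n+[m/n]*n m 5 ⟩
  m % 5 + m / 5 * 5       ≤⟨ +-monoˡ-≤ (m / 5 * 5) (s≤s⁻¹ (m%n<n m 5)) ⟩
  4 + m / 5 * 5           ≡⟨ +-comm 4 (m / 5 * 5) ⟩
  m / 5 * 5 + 4           ≡⟨ cong (_+ 4) (*-comm (m / 5) 5) ⟩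
  5 * (m / 5) + 4         ∎
  where open ≤-Reasoning

m*n≤o*n+p⇒m*q≤o*q+p : ∀ {m n o p q} .{{_ : NonZero n}} → m * n ≤ o * n + p → q ≤ n → m * q ≤ o * q + p
m*n≤o*n+p⇒m*q≤o*q+p {m} {n} {o} {p} {q} mn≤on+p q≤n = *-cancelˡ-≤ n (begin
  n * (m * q)             ≡⟨ solve (m ∷ n ∷ q ∷ []) ⟩
  m * n * q               ≤⟨ *-monoˡ-≤ q mn≤on+p ⟩
  (o * n + p) * q         ≡⟨ solve (n ∷ o ∷ p ∷ q ∷ []) ⟩
  n * (o * q) + p * q     ≤⟨ +-monoʳ-≤ (n * (o * q)) (*-monoʳ-≤ p q≤n) ⟩
  n * (o * q) + p * n     ≡⟨ solve (n ∷ o ∷ p ∷ q ∷ []) ⟩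
  n * (o * q + p)         ∎)
  where open ≤-Reasoning

-- 15x² − (20m + 9)x + 5m² − m − 6 = (x − (m + 1))(15x − 5m + 6) is non-negative for x = n/c ≥ m + 1.
[20m+9]cn+[m+6]c²≤15n²+5m²c² : ∀ {m c n} → suc m * c ≤ n →
  (20 * m + 9) * c * n + (m + 6) * (c * c) ≤ 15 * n * n + 5 * m * m * (c * c)
[20m+9]cn+[m+6]c²≤15n²+5m²c² {m} {c} {n} [1+m]c≤n with n ∸ suc m * c | m+[n∸m]≡n [1+m]c≤n
... | r | refl = begin
  (20 * m + 9) * c * n + (m + 6) * (c * c)                                 ≤⟨ m≤m+n _ _ ⟩
  (20 * m + 9) * c * n + (m + 6) * (c * c) + r * (c * (10 * m + 21) + 15 * r) ≡⟨ solve (m ∷ c ∷ r ∷ []) ⟩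
  15 * n * n + 5 * m * m * (c * c)                                         ∎
  where open ≤-Reasoning

[20m+9]cn≤15n²+4cS : ∀ {m c n t S} → suc m * c ≤ n → c * t ≤ S → 5 * m * m ≤ 4 * t + m + 6 →
  (20 * m + 9) * c * n ≤ 15 * n * n + 4 * c * S
[20m+9]cn≤15n²+4cS {m} {c} {n} {t} {S} [1+m]c≤n ct≤S 5m²≤4t+m+6 = +-cancelʳ-≤ ((m + 6) * (c * c)) _ _ (begin
  (20 * m + 9) * c * n + (m + 6) * (c * c)       ≤⟨ [20m+9]cn+[m+6]c²≤15n²+5m²c² {m} {c} [1+m]c≤n ⟩
  15 * n * n + 5 * m * m * (c * c)               ≤⟨ +-monoʳ-≤ (15 * n * n) (*-monoˡ-≤ (c * c) 5m²≤4t+m+6) ⟩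
  15 * n * n + (4 * t + m + 6) * (c * c)         ≡⟨ solve (m ∷ c ∷ n ∷ t ∷ []) ⟩
  15 * n * n + 4 * c * (c * t) + (m + 6) * (c * c)
    ≤⟨ +-monoˡ-≤ ((m + 6) * (c * c)) (+-monoʳ-≤ (15 * n * n) (*-monoʳ-≤ (4 * c) ct≤S)) ⟩
  15 * n * n + 4 * c * S + (m + 6) * (c * c)     ∎)
  where open ≤-Reasoning

-- d − S/q ≤ 15n/(4c) + 7/4 with the denominators cleared.
diameter-bound-ℕ : ∀ {n q c m d t S} .{{_ : NonZero n}} → q ≤ n → suc m * c ≤ n → c * t ≤ S →
  5 * m * m ≤ 4 * t + m + 6 → d ≤ 5 * m + 4 →
  d * (4 * c * 4 * q) ≤ (15 * n * 4 + 7 * (4 * c)) * q + S * (4 * c * 4)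
diameter-bound-ℕ {n} {q} {c} {m} {d} {t} {S} q≤n [1+m]c≤n ct≤S 5m²≤4t+m+6 d≤5m+4 = begin
  d * (4 * c * 4 * q)                                  ≤⟨ *-monoˡ-≤ (4 * c * 4 * q) d≤5m+4 ⟩
  (5 * m + 4) * (4 * c * 4 * q)                        ≡⟨ solve (m ∷ q ∷ c ∷ []) ⟩
  4 * ((20 * m + 9) * c * q) + 28 * c * q              ≤⟨ +-monoˡ-≤ (28 * c * q) (*-monoʳ-≤ 4 rescaled) ⟩
  4 * (15 * n * q + 4 * c * S) + 28 * c * q            ≡⟨ solve (n ∷ q ∷ c ∷ S ∷ []) ⟩
  (15 * n * 4 + 7 * (4 * c)) * q + S * (4 * c * 4)     ∎
  where
  open ≤-Reasoning
  rescaled : (20 * m + 9) * c * q ≤ 15 * n * q + 4 * c * S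
  rescaled = m*n≤o*n+p⇒m*q≤o*q+p {(20 * m + 9) * c} {o = 15 * n}
               ([20m+9]cn≤15n²+4cS {m} {c} {t = t} [1+m]c≤n ct≤S 5m²≤4t+m+6) q≤n

a≤x/R+y/S+b/Q : ∀ a b x y q r s → a * (suc r * suc s * suc q) ≤ (x * suc s + y * suc r) * suc q + b * (suc r * suc s) →
  mkℚᵘ (ℤ.+ a) 0 ℚᵘ.≤ (mkℚᵘ (ℤ.+ x) r ℚᵘ.+ mkℚᵘ (ℤ.+ y) s) ℚᵘ.+ mkℚᵘ (ℤ.+ b) q
a≤x/R+y/S+b/Q a b x y q r s h = *≤* (subst₂ ℤ._≤_ (pos-* a _) numerator (+≤+ h))
  where
  R S Q : ℕ
  R = suc r
  S = suc s
  Q = suc q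
  numerator : ℤ.+ ((x * S + y * R) * Q + b * (R * S)) ≡
              ((ℤ.+ x ℤ.* ℤ.+ S ℤ.+ ℤ.+ y ℤ.* ℤ.+ R) ℤ.* ℤ.+ Q ℤ.+ ℤ.+ b ℤ.* ℤ.+ (R * S)) ℤ.* ℤ.+ 1
  numerator = begin
    ℤ.+ ((x * S + y * R) * Q + b * (R * S))
      ≡⟨ cong₂ ℤ._+_ (pos-* (x * S + y * R) Q) (pos-* b (R * S)) ⟩
    ℤ.+ (x * S + y * R) ℤ.* ℤ.+ Q ℤ.+ ℤ.+ b ℤ.* ℤ.+ (R * S)
      ≡⟨ cong (λ t → t ℤ.* ℤ.+ Q ℤ.+ ℤ.+ b ℤ.* ℤ.+ (R * S)) (cong₂ ℤ._+_ (pos-* x S) (pos-* y R)) ⟩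
    (ℤ.+ x ℤ.* ℤ.+ S ℤ.+ ℤ.+ y ℤ.* ℤ.+ R) ℤ.* ℤ.+ Q ℤ.+ ℤ.+ b ℤ.* ℤ.+ (R * S)
      ≡⟨ ℤ-*-identityʳ _ ⟨
    ((ℤ.+ x ℤ.* ℤ.+ S ℤ.+ ℤ.+ y ℤ.* ℤ.+ R) ℤ.* ℤ.+ Q ℤ.+ ℤ.+ b ℤ.* ℤ.+ (R * S)) ℤ.* ℤ.+ 1 ∎
    where open ≡-Reasoning

a-b/Q≤x/R+y/S : ∀ a b x y q r s → a * (suc r * suc s * suc q) ≤ (x * suc s + y * suc r) * suc q + b * (suc r * suc s) →
  (ℤ.+ a ℚ./ 1) ℚ.- (ℤ.+ b ℚ./ suc q) ℚ.≤ (ℤ.+ x ℚ./ suc r) ℚ.+ (ℤ.+ y ℚ./ suc s)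
a-b/Q≤x/R+y/S a b x y q r s h =
  toℚᵘ-cancel-≤ (ℚᵘ.≤-respˡ-≃ (ℚᵘ.≃-sym lhs) (ℚᵘ.≤-respʳ-≃ (ℚᵘ.≃-sym rhs) A-B≤X+Y))
  where
  A B X Y : ℚᵘ.ℚᵘ
  A = mkℚᵘ (ℤ.+ a) 0
  B = mkℚᵘ (ℤ.+ b) q
  X = mkℚᵘ (ℤ.+ x) r
  Y = mkℚᵘ (ℤ.+ y) s
  A-B≤X+Y : A ℚᵘ.- B ℚᵘ.≤ X ℚᵘ.+ Y
  A-B≤X+Y = ℚᵘ.≤-respʳ-≃ (ℚᵘ.≃-trans (ℚᵘ.+-assoc (X ℚᵘ.+ Y) B (ℚᵘ.- B))
                           (ℚᵘ.≃-trans (ℚᵘ.+-congʳ (X ℚᵘ.+ Y) (ℚᵘ.+-inverseʳ B)) (ℚᵘ.+-identityʳ (X ℚᵘ.+ Y))))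
                         (ℚᵘ.+-monoˡ-≤ (ℚᵘ.- B) (a≤x/R+y/S+b/Q a b x y q r s h))
  lhs : ℚ.toℚᵘ (ℚ.fromℚᵘ A ℚ.- ℚ.fromℚᵘ B) ℚᵘ.≃ A ℚᵘ.- B
  lhs = ℚᵘ.≃-trans (toℚᵘ-homo-+ (ℚ.fromℚᵘ A) (ℚ.- ℚ.fromℚᵘ B))
          (ℚᵘ.+-cong (toℚᵘ-fromℚᵘ A) (ℚᵘ.≃-trans (toℚᵘ-homo‿- (ℚ.fromℚᵘ B)) (ℚᵘ.-‿cong (toℚᵘ-fromℚᵘ B))))
  rhs : ℚ.toℚᵘ (ℚ.fromℚᵘ X ℚ.+ ℚ.fromℚᵘ Y) ℚᵘ.≃ X ℚᵘ.+ Y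
  rhs = ℚᵘ.≃-trans (toℚᵘ-homo-+ (ℚ.fromℚᵘ X) (ℚ.fromℚᵘ Y)) (ℚᵘ.+-cong (toℚᵘ-fromℚᵘ X) (toℚᵘ-fromℚᵘ Y))

-- Graphs, walks and distances

module _ {n : ℕ} (G : Graph n) where

  private
    variable
      u v w : Fin n
      l : ℕ

  Adj-sym : Adj G u v → Adj G v u
  Adj-sym {u} {v} = subst T (adj-sym G u v)

  Adj⇒≢ : Adj G u v → u ≢ v
  Adj⇒≢ {u} uv refl = subst T (irrefl G u) uv

  _++ʷ_ : Walk G u v k → Walk G v w l → Walk G u w (k + l)
  here ++ʷ q = q
  step a p ++ʷ q = step a (p ++ʷ q)

  reverseʷ : Walk G u v k → Walk G v u k
  reverseʷ here = here
  reverseʷ {k = suc k} (step a p) = subst (Walk G _ _) (+-comm k 1) (reverseʷ p ++ʷ step (Adj-sym a) here)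

  splitʷ : Walk G u v k → (j : ℕ) → j ≤ k → Σ (Fin n) λ x → Walk G u x j × Walk G x v (k ∸ j)
  splitʷ {u} p zero _ = u , here , p
  splitʷ (step a p) (suc j) (s≤s j≤k) with x , p₁ , p₂ ← splitʷ p j j≤k = x , step a p₁ , p₂

  edge : Fin n → Fin n → ℕ
  edge u w = 𝟙 (adj G u w)

  edge-sym : ∀ u w → edge u w ≡ edge w u
  edge-sym u w = cong 𝟙 (adj-sym G u w)

  edge-irrefl : ∀ u → edge u u ≡ 0
  edge-irrefl u = cong 𝟙 (irrefl G u)

  degree≡∑edge : ∀ v → degree G v ≡ ∑[ w < n ] edge v w
  degree≡∑edge v = length-filterᵇ-tabulate (adj G v) id

  common : Fin n → Fin n → ℕ
  common u w = ∑[ x < n ] (edge u x * edge x w)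

  -- Twice the number of edges inside the neighbourhood of y.
  closedWalks₃ : Fin n → ℕ
  closedWalks₃ y = ∑[ u < n ] (edge y u * common u y)

  closedWalks₃-even : ∀ y → ∃ λ h → closedWalks₃ y ≡ h + h
  closedWalks₃-even y = map₂ (trans (sum-cong-≗ λ u → *-distribˡ-sum (edge y u) (λ w → edge u w * edge w y)))
                              (sum-symmetric-even walk walk-sym walk-diagonal)
    where
    walk : Fin n → Fin n → ℕ
    walk u w = edge y u * (edge u w * edge w y)
    walk-sym : ∀ u w → walk u w ≡ walk w u
    walk-sym u w = trans (cong₂ _*_ (edge-sym y u) (cong₂ _*_ (edge-sym u w) (edge-sym w y)))
                         (reverse (edge u y) (edge w u) (edge y w))
      where
      reverse : ∀ a b c → a * (b * c) ≡ c * (b * a)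
      reverse = solve-∀
    walk-diagonal : ∀ u → walk u u ≡ 0
    walk-diagonal u rewrite edge-irrefl u = *-zeroʳ (edge y u)

  edge*edge≤1 : ∀ u x w → edge u x * edge x w ≤ 1
  edge*edge≤1 u x w = ≤-trans (𝟙*≤ (adj G u x) (edge x w)) (𝟙≤1 (adj G x w))

  edge*edge>0 : ∀ u x w → 0 < edge u x * edge x w → Adj G u x × Adj G x w
  edge*edge>0 u x w p with adj G u x | adj G x w
  ... | true | true = tt , tt

ball₂ : ∀ {n} → (Fin n → Fin n → ℕ) → Fin n → ℕ
ball₂ {n} D y = ∑[ w < n ] 𝟙 (D y w ≤ᵇ 2)

module Distance {n : ℕ} {G : Graph n} {D : Fin n → Fin n → ℕ} (isD : IsDistance G D) where

  private
    variable
      u v w : Fin n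

  geodesic : ∀ u v → Walk G u v (D u v)
  geodesic u v = proj₁ (isD u v)

  D-minimal : Walk G u v k → D u v ≤ k
  D-minimal {u} {v} {k} = proj₂ (isD u v) k

  D-sym : ∀ u v → D u v ≡ D v u
  D-sym u v = ≤-antisym (D-minimal (reverseʷ G (geodesic v u))) (D-minimal (reverseʷ G (geodesic u v)))

  D-triangle : ∀ u v w → D u w ≤ D u v + D v w
  D-triangle u v w = D-minimal (_++ʷ_ G (geodesic u v) (geodesic v w))

  D-refl : ∀ u → D u u ≡ 0
  D-refl u = n≤0⇒n≡0 (D-minimal {u} here)

  D≡0⇒≡ : D u v ≡ 0 → u ≡ v
  D≡0⇒≡ {u} {v} D≡0 with here ← subst (Walk G u v) D≡0 (geodesic u v) = refl

  D≡1⇒Adj : D u v ≡ 1 → Adj G u v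
  D≡1⇒Adj {u} {v} D≡1 with step uv here ← subst (Walk G u v) D≡1 (geodesic u v) = uv

  Adj⇒D≡1 : Adj G u v → D u v ≡ 1
  Adj⇒D≡1 {u} {v} uv with D u v in D≡ | D-minimal {u} {v} (step uv here)
  ... | zero | _ = ⊥-elim (Adj⇒≢ G uv (D≡0⇒≡ D≡))
  ... | suc zero | _ = refl
  ... | 2+ _ | s≤s ()

  D≤2 : Adj G u v → Adj G v w → D u w ≤ 2
  D≤2 uv vw = D-minimal (step uv (step vw here))

  ∣D-D∣≤D : ∀ u v w → ∣ D u v - D u w ∣ ≤ D v w
  ∣D-D∣≤D u v w = ∣m-n∣≤o (≤-trans (D-triangle u w v) (≤-reflexive (cong (D u w +_) (D-sym w v))))
                          (D-triangle u v w)

  point-at-distance : ∀ x y j → j ≤ D x y → Σ (Fin n) λ z → D x z ≡ j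
  point-at-distance x y j j≤d with z , p₁ , p₂ ← splitʷ G (geodesic x y) j j≤d =
    z , ≤-antisym (D-minimal p₁) (+-cancelʳ-≤ (D x y ∸ j) j (D x z) (begin
      j + (D x y ∸ j)     ≡⟨ m+[n∸m]≡n j≤d ⟩
      D x y               ≤⟨ D-triangle x z y ⟩
      D x z + D z y       ≤⟨ +-monoʳ-≤ (D x z) (D-minimal p₂) ⟩
      D x z + (D x y ∸ j) ∎))
    where open ≤-Reasoning

  sum-𝟙[D≡0] : ∀ y → ∑[ w < n ] 𝟙 (D y w ≡ᵇ 0) ≡ 1
  sum-𝟙[D≡0] y = ≤-antisym
    (sum≤-atMostOneNonZero _ (λ w → 𝟙≤1 _) λ w w′ p q → trans (sym (D≡0⇒≡ (𝟙[≡0] p))) (D≡0⇒≡ (𝟙[≡0] q)))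
    (≤-trans (≤-reflexive (cong (λ d → 𝟙 (d ≡ᵇ 0)) (sym (D-refl y)))) (f≤sum (λ w → 𝟙 (D y w ≡ᵇ 0)) y))
    where
    𝟙[≡0] : ∀ {d} → 0 < 𝟙 (d ≡ᵇ 0) → d ≡ 0
    𝟙[≡0] {zero} _ = refl

  edge≡𝟙[D≡1] : ∀ u v → edge G u v ≡ 𝟙 (D u v ≡ᵇ 1)
  edge≡𝟙[D≡1] u v with adj G u v in uv
  ... | true = cong (λ d → 𝟙 (d ≡ᵇ 1)) (sym (Adj⇒D≡1 (subst T (sym uv) tt)))
  ... | false with D u v in D≡
  ...   | 0 = refl
  ...   | 1 with () ← subst T uv (D≡1⇒Adj D≡)
  ...   | 2+ _ = refl

  farNeighbours : Fin n → Fin n → ℕ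
  farNeighbours y u = ∑[ w < n ] (edge G u w * 𝟙 (2 ≤ᵇ D y w))

  edge≤ : ∀ y u w → edge G u w ≤ 𝟙 (D y w ≡ᵇ 0) + edge G u w * edge G w y + edge G u w * 𝟙 (2 ≤ᵇ D y w)
  edge≤ y u w = begin
    e                                                          ≡⟨ *-identityʳ e ⟨
    e * 1                                                      ≡⟨ cong (e *_) (𝟙-partition (D y w)) ⟨
    e * (𝟙 (D y w ≡ᵇ 0) + 𝟙 (D y w ≡ᵇ 1) + 𝟙 (2 ≤ᵇ D y w))   ≡⟨ distrib e _ _ _ ⟩
    e * 𝟙 (D y w ≡ᵇ 0) + e * 𝟙 (D y w ≡ᵇ 1) + e * 𝟙 (2 ≤ᵇ D y w)
      ≤⟨ +-monoˡ-≤ _ (+-mono-≤ (𝟙*≤ (adj G u w) (𝟙 (D y w ≡ᵇ 0))) (≤-reflexive (cong (e *_) D≡1-is-edge))) ⟩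
    𝟙 (D y w ≡ᵇ 0) + e * edge G w y + e * 𝟙 (2 ≤ᵇ D y w)     ∎
    where
    open ≤-Reasoning
    e : ℕ
    e = edge G u w
    distrib : ∀ a b c d → a * (b + c + d) ≡ a * b + a * c + a * d
    distrib = solve-∀
    D≡1-is-edge : 𝟙 (D y w ≡ᵇ 1) ≡ edge G w y
    D≡1-is-edge = trans (sym (edge≡𝟙[D≡1] y w)) (edge-sym G y w)

  degree≤ : ∀ y u → degree G u ≤ 1 + common G u y + farNeighbours y u
  degree≤ y u = begin
    degree G u                                    ≡⟨ degree≡∑edge G u ⟩
    ∑[ w < n ] edge G u w                         ≤⟨ sum-mono-≤ (edge≤ y u) ⟩
    ∑[ w < n ] (𝟙 (D y w ≡ᵇ 0) + edge G u w * edge G w y + edge G u w * 𝟙 (2 ≤ᵇ D y w))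
      ≡⟨ ∑-distrib-+₃ (λ w → 𝟙 (D y w ≡ᵇ 0)) (λ w → edge G u w * edge G w y) (λ w → edge G u w * 𝟙 (2 ≤ᵇ D y w)) ⟩
    ∑[ w < n ] 𝟙 (D y w ≡ᵇ 0) + common G u y + farNeighbours y u
      ≡⟨ cong (λ t → t + common G u y + farNeighbours y u) (sum-𝟙[D≡0] y) ⟩
    1 + common G u y + farNeighbours y u          ∎
    where open ≤-Reasoning

  ∑edge*farNeighbours : ∀ y → ∑[ u < n ] (edge G y u * farNeighbours y u) ≡ ∑[ w < n ] (common G y w * 𝟙 (2 ≤ᵇ D y w))
  ∑edge*farNeighbours y = begin
    ∑[ u < n ] (edge G y u * ∑[ w < n ] (edge G u w * far w))
      ≡⟨ sum-cong-≗ (λ u → *-distribˡ-sum (edge G y u) (λ w → edge G u w * far w)) ⟩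
    ∑[ u < n ] ∑[ w < n ] (edge G y u * (edge G u w * far w))  ≡⟨ ∑-comm (λ u w → edge G y u * (edge G u w * far w)) ⟩
    ∑[ w < n ] ∑[ u < n ] (edge G y u * (edge G u w * far w))
      ≡⟨ sum-cong-≗ (λ w → sum-cong-≗ λ u → *-assoc (edge G y u) (edge G u w) (far w)) ⟨
    ∑[ w < n ] ∑[ u < n ] (edge G y u * edge G u w * far w)
      ≡⟨ sum-cong-≗ (λ w → *-distribʳ-sum (far w) (λ u → edge G y u * edge G u w)) ⟨
    ∑[ w < n ] (common G y w * far w)                          ∎
    where
    open ≡-Reasoning
    far : Fin n → ℕ
    far w = 𝟙 (2 ≤ᵇ D y w)

-- Balls of radius 2 in C₄-free graphs

module _ {n : ℕ} {G : Graph n} {D : Fin n → Fin n → ℕ} (isD : IsDistance G D) (c4 : C4Free G) where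
  open Distance isD

  private
    variable
      u v w x x′ : Fin n

  common-neighbour-unique : u ≢ w → Adj G u x → Adj G x w → Adj G u x′ → Adj G x′ w → x ≡ x′
  common-neighbour-unique {u} {w} {x} {x′} u≢w ux xw ux′ x′w with x Data.Fin.≟ x′
  ... | yes x≡x′ = x≡x′
  ... | no x≢x′ = ⊥-elim (c4 (u , x , w , x′ , Adj⇒≢ G ux , u≢w , Adj⇒≢ G ux′ , Adj⇒≢ G xw , x≢x′ ,
                              Adj⇒≢ G (Adj-sym G x′w) , ux , xw , Adj-sym G x′w , Adj-sym G ux′))

  common≤1 : u ≢ w → common G u w ≤ 1
  common≤1 {u} {w} u≢w = sum≤-atMostOneNonZero _ (λ x → edge*edge≤1 G u x w) λ x x′ p q →
    let ux , xw = edge*edge>0 G u x w p ; ux′ , x′w = edge*edge>0 G u x′ w q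
    in common-neighbour-unique u≢w ux xw ux′ x′w

  common*𝟙[2≤D]≤𝟙[D≡2] : ∀ y w → common G y w * 𝟙 (2 ≤ᵇ D y w) ≤ 𝟙 (D y w ≡ᵇ 2)
  common*𝟙[2≤D]≤𝟙[D≡2] y w with D y w in D≡
  ... | 0 = ≤-reflexive (*-zeroʳ (common G y w))
  ... | 1 = ≤-reflexive (*-zeroʳ (common G y w))
  ... | 2 = subst (_≤ 1) (sym (*-identityʳ (common G y w))) (common≤1 λ { refl → 0≢1+n (trans (sym (D-refl y)) D≡) })
  ... | suc (2+ _) = subst (_≤ 0) (sym (*-identityʳ (common G y w)))
                      (≤-trans (sum-mono-≤ no-common-neighbour) (≤-reflexive (sum-zero n)))
    where
    no-common-neighbour : ∀ x → edge G y x * edge G x w ≤ 0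
    no-common-neighbour x with edge G y x * edge G x w in eq
    ... | zero = z≤n
    ... | suc _ with yx , xw ← edge*edge>0 G y x w (subst (0 <_) (sym eq) z<s)
                with s≤s (s≤s ()) ← subst (_≤ 2) D≡ (D≤2 yx xw)

  1+degree+∑common≤ball₂ : ∀ y → 1 + degree G y + ∑[ w < n ] (common G y w * 𝟙 (2 ≤ᵇ D y w)) ≤ ball₂ D y
  1+degree+∑common≤ball₂ y = begin
    1 + degree G y + ∑[ w < n ] c w
      ≡⟨ cong₂ (λ a b → a + b + ∑[ w < n ] c w) (sym (sum-𝟙[D≡0] y)) (degree≡∑edge G y) ⟩
    ∑[ w < n ] 𝟙 (D y w ≡ᵇ 0) + ∑[ w < n ] edge G y w + ∑[ w < n ] c w
      ≡⟨ ∑-distrib-+₃ (λ w → 𝟙 (D y w ≡ᵇ 0)) (edge G y) c ⟨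
    ∑[ w < n ] (𝟙 (D y w ≡ᵇ 0) + edge G y w + c w)
      ≤⟨ sum-mono-≤ pointwise ⟩
    ball₂ D y ∎
    where
    open ≤-Reasoning
    c : Fin n → ℕ
    c w = common G y w * 𝟙 (2 ≤ᵇ D y w)
    pointwise : ∀ w → 𝟙 (D y w ≡ᵇ 0) + edge G y w + c w ≤ 𝟙 (D y w ≤ᵇ 2)
    pointwise w = ≤-trans (+-mono-≤ (≤-reflexive (cong (𝟙 (D y w ≡ᵇ 0) +_) (edge≡𝟙[D≡1] y w)))
                                    (common*𝟙[2≤D]≤𝟙[D≡2] y w))
                          (≤-reflexive (𝟙-≤ᵇ2-partition (D y w)))

  closedWalks₃≤degree : ∀ y → closedWalks₃ G y ≤ degree G y
  closedWalks₃≤degree y = subst (closedWalks₃ G y ≤_) (sym (degree≡∑edge G y)) (sum-mono-≤ pointwise)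
    where
    pointwise : ∀ u → edge G y u * common G u y ≤ edge G y u
    pointwise u with adj G y u in yu
    ... | false = z≤n
    ... | true = subst (_≤ 1) (sym (+-identityʳ _)) (common≤1 (Adj⇒≢ G (Adj-sym G (subst T (sym yu) tt))))

  1+degree*δ≤ball₂+closedWalks₃ : ∀ {δ} → (∀ v → δ ≤ degree G v) → ∀ y →
    1 + degree G y * δ ≤ ball₂ D y + closedWalks₃ G y
  1+degree*δ≤ball₂+closedWalks₃ {δ} δ≤degree y = begin
    1 + degree G y * δ                            ≡⟨ cong (λ g → 1 + g * δ) (degree≡∑edge G y) ⟩
    1 + (∑[ u < n ] edge G y u) * δ               ≡⟨ cong suc (*-distribʳ-sum δ (edge G y)) ⟩
    1 + ∑[ u < n ] (edge G y u * δ)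
      ≤⟨ s≤s (sum-mono-≤ λ u → *-monoʳ-≤ (edge G y u) (≤-trans (δ≤degree u) (degree≤ y u))) ⟩
    1 + ∑[ u < n ] (edge G y u * (1 + common G u y + farNeighbours y u))
      ≡⟨ cong suc (trans (sum-cong-≗ λ u → distrib (edge G y u) (common G u y) (farNeighbours y u))
                         (∑-distrib-+₃ (edge G y) (λ u → edge G y u * common G u y) (λ u → edge G y u * farNeighbours y u))) ⟩
    1 + (∑[ u < n ] edge G y u + closedWalks₃ G y + ∑[ u < n ] (edge G y u * farNeighbours y u))
      ≡⟨ cong₂ (λ g t → 1 + (g + closedWalks₃ G y + t)) (sym (degree≡∑edge G y)) (∑edge*farNeighbours y) ⟩
    1 + (degree G y + closedWalks₃ G y + ∑[ w < n ] (common G y w * 𝟙 (2 ≤ᵇ D y w)))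
      ≡⟨ rearrange (degree G y) (closedWalks₃ G y) _ ⟩
    1 + degree G y + ∑[ w < n ] (common G y w * 𝟙 (2 ≤ᵇ D y w)) + closedWalks₃ G y
      ≤⟨ +-monoˡ-≤ (closedWalks₃ G y) (1+degree+∑common≤ball₂ y) ⟩
    ball₂ D y + closedWalks₃ G y ∎
    where
    open ≤-Reasoning
    distrib : ∀ e c f → e * (1 + c + f) ≡ e + e * c + e * f
    distrib = solve-∀
    rearrange : ∀ g m t → 1 + (g + m + t) ≡ 1 + g + t + m
    rearrange = solve-∀

  minBall₂≤ball₂ : ∀ {δ} → 2 ≤ δ → (∀ v → δ ≤ degree G v) → ∀ y → minBall₂ δ ≤ ball₂ D y
  minBall₂≤ball₂ {δ} 2≤δ δ≤degree y with h , cw≡h+h ← closedWalks₃-even G y =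
    minBall₂≤ {h = h} 2≤δ (δ≤degree y) (subst (_≤ degree G y) cw≡h+h (closedWalks₃≤degree y))
              (subst (λ t → 1 + degree G y * δ ≤ ball₂ D y + t) cw≡h+h (1+degree*δ≤ball₂+closedWalks₃ δ≤degree y))

-- Disjoint balls along a diametral path

module Packing {n : ℕ} {G : Graph n} {D : Fin n → Fin n → ℕ} (isD : IsDistance G D)
               {c : ℕ} (c≤ball₂ : ∀ y → c ≤ ball₂ D y) (x₀ x₁ : Fin n) where
  open Distance isD

  m : ℕ
  m = D x₀ x₁ / 5

  5i≤D : (i : Fin (suc m)) → 5 * toℕ i ≤ D x₀ x₁
  5i≤D i = ≤-trans (*-monoʳ-≤ 5 (s≤s⁻¹ (toℕ<n i)))
                   (subst (_≤ D x₀ x₁) (*-comm (D x₀ x₁ / 5) 5) (m/n*n≤m (D x₀ x₁) 5))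

  centre : Fin (suc m) → Fin n
  centre i = proj₁ (point-at-distance x₀ x₁ (5 * toℕ i) (5i≤D i))

  D-centre : ∀ i → D x₀ (centre i) ≡ 5 * toℕ i
  D-centre i = proj₂ (point-at-distance x₀ x₁ (5 * toℕ i) (5i≤D i))

  balls-disjoint : ∀ {i j w} → D (centre i) w ≤ 2 → D (centre j) w ≤ 2 → i ≡ j
  balls-disjoint {i} {j} {w} iw≤2 jw≤2 = toℕ-injective (∣5m-5n∣≤4⇒m≡n (begin
    ∣ 5 * toℕ i - 5 * toℕ j ∣                     ≡⟨ cong₂ ∣_-_∣ (D-centre i) (D-centre j) ⟨
    ∣ D x₀ (centre i) - D x₀ (centre j) ∣         ≤⟨ ∣D-D∣≤D x₀ (centre i) (centre j) ⟩
    D (centre i) (centre j)                       ≤⟨ D-triangle (centre i) w (centre j) ⟩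
    D (centre i) w + D w (centre j)               ≤⟨ +-mono-≤ iw≤2 (subst (_≤ 2) (D-sym (centre j) w) jw≤2) ⟩
    4                                             ∎))
    where open ≤-Reasoning

  c*∑≤∑ : (f : Fin (suc m) → ℕ) (X : Fin n → ℕ) → (∀ i w → D (centre i) w ≤ 2 → f i ≤ X w) →
    c * ∑[ i < suc m ] f i ≤ ∑[ w < n ] X w
  c*∑≤∑ f X f≤X = begin
    c * ∑[ i < suc m ] f i                          ≡⟨ *-distribˡ-sum c f ⟩
    ∑[ i < suc m ] (c * f i)                        ≤⟨ sum-mono-≤ (λ i → *-monoˡ-≤ (f i) (c≤ball₂ (centre i))) ⟩
    ∑[ i < suc m ] (ball₂ D (centre i) * f i)     ≡⟨ sum-cong-≗ (λ i → *-distribʳ-sum (f i) (λ w → inBall i w)) ⟩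
    ∑[ i < suc m ] ∑[ w < n ] (inBall i w * f i)    ≡⟨ ∑-comm (λ i w → inBall i w * f i) ⟩
    ∑[ w < n ] ∑[ i < suc m ] (inBall i w * f i)    ≤⟨ sum-mono-≤ (λ w → sum≤-atMostOneNonZero _
                                                         (λ i → 𝟙*≤-if _ (f≤X i w ∘ ≤ᵇ⇒≤ _ 2))
                                                         (λ i j p q → balls-disjoint (in-ball p) (in-ball q))) ⟩
    ∑[ w < n ] X w                                  ∎
    where
    open ≤-Reasoning
    inBall : Fin (suc m) → Fin n → ℕ
    inBall i w = 𝟙 (D (centre i) w ≤ᵇ 2)
    in-ball : ∀ {i w} → 0 < inBall i w * f i → D (centre i) w ≤ 2
    in-ball {i} {w} p = ≤ᵇ⇒≤ _ 2 (𝟙*>0 (D (centre i) w ≤ᵇ 2) p)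

  [1+m]*c≤n : suc m * c ≤ n
  [1+m]*c≤n = begin
    suc m * c                 ≡⟨ *-comm (suc m) c ⟩
    c * suc m                 ≡⟨ cong (c *_) (trans (sym (*-identityʳ (suc m))) (sym (sum-const (suc m) 1))) ⟩
    c * ∑[ i < suc m ] 1      ≤⟨ c*∑≤∑ (λ _ → 1) (λ _ → 1) (λ _ _ _ → ≤-refl) ⟩
    ∑[ w < n ] 1              ≡⟨ trans (sum-const n 1) (*-identityʳ n) ⟩
    n                         ∎
    where open ≤-Reasoning

  c*∑∣5i-D∣∸2≤∑D : ∀ v → c * ∑[ i < suc m ] (∣ 5 * toℕ i - D x₀ v ∣ ∸ 2) ≤ ∑[ w < n ] D v w
  c*∑∣5i-D∣∸2≤∑D v = c*∑≤∑ _ (D v) λ i w iw≤2 → m≤n+o⇒m∸n≤o _ 2 (begin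
    ∣ 5 * toℕ i - D x₀ v ∣             ≡⟨ cong (λ t → ∣ t - D x₀ v ∣) (D-centre i) ⟨
    ∣ D x₀ (centre i) - D x₀ v ∣       ≤⟨ ∣D-D∣≤D x₀ (centre i) v ⟩
    D (centre i) v                     ≤⟨ D-triangle (centre i) w v ⟩
    D (centre i) w + D w v             ≤⟨ +-mono-≤ iw≤2 (≤-reflexive (D-sym w v)) ⟩
    2 + D v w                          ∎)
    where open ≤-Reasoning

maxFin-attained : ∀ {k} (f : Fin (suc k) → ℕ) → ∃ λ i → maxFin f ≡ f i
maxFin-attained {zero} f = zero , ⊔-identityʳ (f zero)
maxFin-attained {suc k} f with ⊔-sel (f zero) (maxFin (f ∘ suc))
... | inj₁ max≡f₀ = zero , max≡f₀
... | inj₂ max≡rest with i , rest≡fᵢ ← maxFin-attained (f ∘ suc) = suc i , trans max≡rest rest≡fᵢ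

minFinℚ-attained : ∀ {k} (f : Fin (suc k) → ℚ) → ∃ λ i → minFinℚ f ≡ f i
minFinℚ-attained {zero} f = zero , refl
minFinℚ-attained {suc k} f with ℚ-⊓-sel (f zero) (minFinℚ (f ∘ suc))
... | inj₁ min≡f₀ = zero , min≡f₀
... | inj₂ min≡rest with i , rest≡fᵢ ← minFinℚ-attained (f ∘ suc) = suc i , trans min≡rest rest≡fᵢ

diam-attained : ∀ {k} (D : Fin (suc k) → Fin (suc k) → ℕ) → ∃ λ x₀ → ∃ λ x₁ → diam D ≡ D x₀ x₁
diam-attained D with x₀ , diam≡ ← maxFin-attained (λ u → maxFin (D u)) = x₀ , map₂ (trans diam≡) (maxFin-attained (D x₀))

distance-gap : ∀ {q δ} → 2 ≤ δ → (G : Graph (2+ q)) → C4Free G → (∀ v → δ ≤ degree G v) →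
  (D : Fin (2+ q) → Fin (2+ q) → ℕ) → IsDistance G D → ∀ x₀ x₁ v →
  (ℤ.+ D x₀ x₁ ℚ./ 1) ℚ.- σ̄ D v ℚ.≤ bound (2+ q) δ
distance-gap {q} {δ} 2≤δ G c4 δ≤degree D isD x₀ x₁ v =
  a-b/Q≤x/R+y/S (D x₀ x₁) ∑D (15 * n) 7 q _ 3
    (diameter-bound-ℕ {n} {suc q} {minBall₂ δ} {m} {D x₀ x₁} {t} {∑D} (n≤1+n (suc q)) [1+m]*c≤n
      (subst (minBall₂ δ * t ≤_) (sym (sum-map-allFin (D v))) (c*∑∣5i-D∣∸2≤∑D v))
      (5*m*m≤4*∑[∣5i-p∣∸2]+m+6 (D x₀ v) m) (m≤5*[m/5]+4 (D x₀ x₁)))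
  where
  n ∑D : ℕ
  n = 2+ q
  ∑D = List.sum (map (D v) (allFin n))
  open Packing isD (minBall₂≤ball₂ isD c4 2≤δ δ≤degree) x₀ x₁
  t : ℕ
  t = ∑[ i < suc m ] (∣ 5 * toℕ i - D x₀ v ∣ ∸ 2)

-- Connectivity is already implied by the existence of D, and n ≥ 2 suffices.
corollary4p6 : (n δ : ℕ) → 3 ≤ δ → 6 ≤ n →
    (G : Graph n) → Connected G → C4Free G → MinDegree G δ →
    (D : Fin n → Fin n → ℕ) → IsDistance G D →
    ((ℤ.+ diam D) ℚ./ 1) ℚ.- proximity D ℚ.≤ bound n δ
corollary4p6 0 _ _ () _ _ _ _ _ _
corollary4p6 1 _ _ (s≤s ()) _ _ _ _ _ _
corollary4p6 n@(2+ q) δ 3≤δ _ G _ c4 (δ≤degree , _) D isD =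
  subst₂ (λ d p → (ℤ.+ d ℚ./ 1) ℚ.- p ℚ.≤ bound n δ) (sym diam≡) (sym proximity≡)
    (distance-gap (≤-trans (n≤1+n 2) 3≤δ) G c4 δ≤degree D isD x₀ x₁ v)
  where
  x₀ x₁ v : Fin n
  x₀ = proj₁ (diam-attained D)
  x₁ = proj₁ (proj₂ (diam-attained D))
  diam≡ : diam D ≡ D x₀ x₁
  diam≡ = proj₂ (proj₂ (diam-attained D))
  v = proj₁ (minFinℚ-attained (σ̄ D))
  proximity≡ : proximity D ≡ σ̄ D v
  proximity≡ = proj₂ (minFinℚ-attained (σ̄ D))
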